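{- Let $P$ be a finite poset. If $A_1\oplus P$ is LE-cactus, then $A_2\oplus P$ is LE-cactus. Hence if $P$ is LE-cactus, then so are both $A_1\oplus P$ and $A_2\oplus P$.
   Context: For an $n$-element poset $P$, a linear extension is a list $(p_1,\dots,p_n)$ of all elements with $p_a<_P p_b$ implying $a<b$; ${\mathcal{L}}(P)$ is the set of these. The Bender--Knuth move $t_i$ ($1\le i\le n-1$) acts on ${\mathcal{L}}(P)$ by swapping $p_i,p_{i+1}$ if incomparable and fixing the list otherwise; $\mathcal{BK}_P$ is the permutation group they generate. Let $q_m=t_1(t_2t_1)\cdots(t_mt_{m-1}\cdots t_1)$ and $q_{jk}=q_{k-1}q_{k-j}q_{k-1}$. An $n$-element poset is LE-cactus if $(t_iq_{jk})^2=1$ holds in $\mathcal{BK}_P$ for all $2\le i+1<j<k\le n$. $A_m$ denotes an $m$-element antichain, and $A_m\oplus P$ the ordinal sum in which every element of $A_m$ lies below every element of $P$. -}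

module Defs where

open import Data.Nat using (ℕ; zero; suc; _+_; _∸_; _≤_; _<_)
open import Data.Fin as Fin using (Fin; splitAt)
open import Data.Sum using (_⊎_; inj₁; inj₂)
open import Data.Product using (_×_)
open import Data.Empty using (⊥)
open import Data.Unit using (⊤; tt)
open import Data.List using (List; []; _∷_; _++_; length; lookup)
open import Data.List.Membership.Propositional using (_∈_)
open import Data.List.Relation.Unary.Unique.Propositional using (Unique)
open import Relation.Nullary using (¬_; Dec; yes; no)
open import Relation.Nullary.Decidable using (_⊎-dec_)
open import Relation.Binary.PropositionalEquality using (_≡_)

record DecRel : Set₁ where
  field
    size : ℕ
    _≺_  : Fin size → Fin size → Set
    dec  : ∀ x y → Dec (x ≺ y)

record FinPoset : Set₁ where
  field
    rel     : DecRel
  open DecRel rel public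
  field
    irrefl  : ∀ x → ¬ (x ≺ x)
    transit : ∀ {x y z} → x ≺ y → y ≺ z → x ≺ z

module _ (D : DecRel) where
  open DecRel D

  record LinExt : Set where
    field
      seq      : List (Fin size)
      complete : ∀ x → x ∈ seq
      unique   : Unique seq
      order    : ∀ (a b : Fin (length seq)) →
                 lookup seq a ≺ lookup seq b → Fin._<_ a b

  comparable? : ∀ x y → Dec ((x ≺ y) ⊎ (y ≺ x))
  comparable? x y = dec x y ⊎-dec dec y x

  swapAt : ℕ → List (Fin size) → List (Fin size)
  swapAt zero (x ∷ y ∷ r) with comparable? x y
  ... | yes _ = x ∷ y ∷ r
  ... | no  _ = y ∷ x ∷ r
  swapAt zero xs = xs
  swapAt (suc k) [] = []
  swapAt (suc k) (x ∷ r) = x ∷ swapAt k r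

  -- Bender–Knuth move t_i (1-based i): swap p_i and p_{i+1}
  bk : ℕ → List (Fin size) → List (Fin size)
  bk i = swapAt (i ∸ 1)

  act : List ℕ → List (Fin size) → List (Fin size)
  act [] xs = xs
  act (i ∷ w) xs = bk i (act w xs)

down : ℕ → List ℕ
down zero = []
down (suc m) = suc m ∷ down m

q : ℕ → List ℕ             -- q_m = t_1 (t_2 t_1) ... (t_m ... t_1)
q zero = []
q (suc m) = q m ++ down (suc m)

qjk : ℕ → ℕ → List ℕ
qjk j k = q (k ∸ 1) ++ q (k ∸ j) ++ q (k ∸ 1)

cactusWord : ℕ → ℕ → ℕ → List ℕ
cactusWord i j k = (i ∷ qjk j k) ++ (i ∷ qjk j k)

-- LE-cactus: (t_i q_{jk})^2 = 1 in BK_P, i.e. it fixes every linear extension,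
-- for all 2 ≤ i+1 < j < k ≤ n
IsLECactus : DecRel → Set
IsLECactus D = ∀ (i j k : ℕ) → 2 ≤ i + 1 → i + 1 < j → j < k → k ≤ DecRel.size D →
  (L : LinExt D) → act D (cactusWord i j k) (LinExt.seq L) ≡ LinExt.seq L

antichain : ℕ → DecRel
antichain m = record { size = m ; _≺_ = λ _ _ → ⊥ ; dec = λ _ _ → no (λ ()) }

data OrdSumRel (Q R : DecRel) : Fin (DecRel.size Q) ⊎ Fin (DecRel.size R) →
                 Fin (DecRel.size Q) ⊎ Fin (DecRel.size R) → Set where
  inQ  : ∀ {a b} → DecRel._≺_ Q a b → OrdSumRel Q R (inj₁ a) (inj₁ b)
  QR   : ∀ {a b} → OrdSumRel Q R (inj₁ a) (inj₂ b)
  inR  : ∀ {a b} → DecRel._≺_ R a b → OrdSumRel Q R (inj₂ a) (inj₂ b)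

ordSumDec : (Q R : DecRel) → ∀ x y → Dec (OrdSumRel Q R x y)
ordSumDec Q R (inj₁ a) (inj₁ b) with DecRel.dec Q a b
... | yes p = yes (inQ p)
... | no ¬p = no λ { (inQ p) → ¬p p }
ordSumDec Q R (inj₁ a) (inj₂ b) = yes QR
ordSumDec Q R (inj₂ a) (inj₁ b) = no λ ()
ordSumDec Q R (inj₂ a) (inj₂ b) with DecRel.dec R a b
... | yes p = yes (inR p)
... | no ¬p = no λ { (inR p) → ¬p p }

_⊕_ : DecRel → DecRel → DecRel
Q ⊕ R = record
  { size = DecRel.size Q + DecRel.size R
  ; _≺_  = λ x y → OrdSumRel Q R (splitAt (DecRel.size Q) x) (splitAt (DecRel.size Q) y)
  ; dec  = λ x y → ordSumDec Q R (splitAt (DecRel.size Q) x) (splitAt (DecRel.size Q) y)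
  }

-- In a linear extension of A₁ ⊕ P the bottom element comes first and is comparable to
-- everything, so t₁ fixes it and t_{i+1} acts as t_i on the remaining linear extension of P.
-- A cactus word (t_i q_{jk})² thus acts through the word obtained by deleting t₁ and lowering
-- every other index by one: for i = 1 this is the square of q_{j,k-1}, an involution because each
-- q_m equals its reversed word (by q_m t_{m+1}⋯t_1 = t_1⋯t_{m+1} q_m), and for
-- i ≥ 2 it is the cactus word (t_{i-1} q_{j,k-1})², a relation of P (or trivial when k - 1 = j).
-- For A₂ ⊕ P the two bottom elements form a block on which t₁ acts by a swap, t₂ trivially, and
-- t_{i+2} acts on the rest as t_i; a cactus word is a square, so the block returns to itself,
-- and on the rest it acts as a doubly lowered cactus word, which a linear extension of A₁ ⊕ P
-- (delete one bottom element) shows to be trivial.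
module Submission where

open import Defs
open import Data.Bool using (Bool; true; false; not; _xor_)
open import Data.Bool.Properties using (not-distribˡ-xor; not-distribʳ-xor; xor-same; xor-identityʳ)
open import Data.Empty using (⊥-elim)
open import Data.Fin as Fin using (Fin; zero; suc)
open import Data.Fin.Properties using (suc-injective)
open import Data.List using (List; []; _∷_; _++_; lookup; map; reverse)
open import Data.List.Properties using (map-injective; ∷-injectiveʳ; unfold-reverse; reverse-++)
open import Data.List.Membership.Propositional using (_∈_)
open import Data.List.Membership.Propositional.Properties using (∈-lookup)
open import Data.List.Relation.Unary.All as All using (All; []; _∷_)
open import Data.List.Relation.Unary.Any using (here; there; index)
open import Data.List.Relation.Unary.Any.Properties using (lookup-index)
open import Data.List.Relation.Unary.AllPairs using ([]; _∷_)
open import Data.List.Relation.Unary.Unique.Propositional using (Unique)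
open import Data.Nat using (ℕ; zero; suc; _+_; _∸_; _≤_; _<_; z≤n; s≤s)
open import Data.Nat.Properties
  using (≤-trans; ≤-pred; n≤1+n; n<1+n; n≮0; m≤n+m; ≤-<-connex; m≤n⇒m∸n≡0; ∸-monoˡ-≤;
         ∸-+-assoc; +-comm)
open import Data.Product using (_×_; _,_; ∃)
open import Data.Sum using (_⊎_; inj₁; inj₂)
  renaming (map to ⊎-map; map₁ to ⊎-map₁; swap to ⊎-swap)
open import Data.Unit using (⊤; tt)
open import Function using (id; _∘_)
open import Relation.Nullary using (¬_; yes; no)
open import Relation.Binary.PropositionalEquality

module BenderKnuth (D : DecRel) where
  open DecRel D
  open import Algebra.Definitions (_≡_ {A = List (Fin size)}) using (Involutive)

  act-++ : ∀ u v → act D (u ++ v) ≗ act D u ∘ act D v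
  act-++ []      v xs = refl
  act-++ (i ∷ u) v xs = cong (bk D i) (act-++ u v xs)

  swapAt-comparable : ∀ {x y} r → (x ≺ y) ⊎ (y ≺ x) → swapAt D 0 (x ∷ y ∷ r) ≡ x ∷ y ∷ r
  swapAt-comparable {x} {y} r c with comparable? D x y
  ... | yes _ = refl
  ... | no ¬c = ⊥-elim (¬c c)

  swapAt-incomparable : ∀ {x y} r → ¬ ((x ≺ y) ⊎ (y ≺ x)) → swapAt D 0 (x ∷ y ∷ r) ≡ y ∷ x ∷ r
  swapAt-incomparable {x} {y} r ¬c with comparable? D x y
  ... | yes c = ⊥-elim (¬c c)
  ... | no _  = refl

  swapAt-involutive : ∀ k → Involutive (swapAt D k)
  swapAt-involutive zero    []          = refl
  swapAt-involutive zero    (x ∷ [])    = refl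
  swapAt-involutive zero    (x ∷ y ∷ r) with comparable? D x y
  ... | yes c = swapAt-comparable r c
  ... | no ¬c = swapAt-incomparable r (¬c ∘ ⊎-swap)
  swapAt-involutive (suc k) []          = refl
  swapAt-involutive (suc k) (x ∷ r)     = cong (x ∷_) (swapAt-involutive k r)

  swapAt-comm : ∀ a b → 2 + a ≤ b → ∀ xs → swapAt D a (swapAt D b xs) ≡ swapAt D b (swapAt D a xs)
  swapAt-comm zero    (suc zero)    (s≤s ())
  swapAt-comm zero    (suc (suc b)) _ []          = refl
  swapAt-comm zero    (suc (suc b)) _ (x ∷ [])    = refl
  swapAt-comm zero    (suc (suc b)) _ (x ∷ y ∷ r) with comparable? D x y
  ... | yes _ = refl
  ... | no _  = refl
  swapAt-comm (suc a) (suc b) _         []      = refl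
  swapAt-comm (suc a) (suc b) (s≤s a<b) (x ∷ r) = cong (x ∷_) (swapAt-comm a b a<b r)

  bk-involutive : ∀ i → Involutive (bk D i)
  bk-involutive i = swapAt-involutive (i ∸ 1)

  act-reverse : ∀ w xs → act D (reverse w) (act D w xs) ≡ xs
  act-reverse []      xs = refl
  act-reverse (i ∷ w) xs = begin
    act D (reverse (i ∷ w)) (bk D i (act D w xs))
      ≡⟨ cong (λ u → act D u (bk D i (act D w xs))) (unfold-reverse i w) ⟩
    act D (reverse w ++ i ∷ []) (bk D i (act D w xs)) ≡⟨ act-++ (reverse w) (i ∷ []) _ ⟩
    act D (reverse w) (bk D i (bk D i (act D w xs)))  ≡⟨ cong (act D (reverse w)) (bk-involutive i _) ⟩
    act D (reverse w) (act D w xs)                    ≡⟨ act-reverse w xs ⟩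
    xs                                                ∎
    where open ≡-Reasoning

  bk-down-comm : ∀ i l → l < i → bk D (suc i) ∘ act D (down l) ≗ act D (down l) ∘ bk D (suc i)
  bk-down-comm i zero    _   xs = refl
  bk-down-comm i (suc l) l<i xs =
    trans (sym (swapAt-comm l i l<i _)) (cong (swapAt D l) (bk-down-comm i l (≤-trans (n≤1+n _) l<i) xs))

  bk-q-comm : ∀ i n → n < i → bk D (suc i) ∘ act D (q n) ≗ act D (q n) ∘ bk D (suc i)
  bk-q-comm i zero    _   xs = refl
  bk-q-comm i (suc n) n<i xs = begin
    bk D (suc i) (act D (q n ++ down (suc n)) xs)         ≡⟨ cong (bk D (suc i)) (act-++ (q n) _ xs) ⟩
    bk D (suc i) (act D (q n) (act D (down (suc n)) xs))  ≡⟨ bk-q-comm i n (≤-trans (n≤1+n _) n<i) _ ⟩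
    act D (q n) (bk D (suc i) (act D (down (suc n)) xs))  ≡⟨ cong (act D (q n)) (bk-down-comm i (suc n) n<i xs) ⟩
    act D (q n) (act D (down (suc n)) (bk D (suc i) xs))  ≡⟨ act-++ (q n) _ _ ⟨
    act D (q n ++ down (suc n)) (bk D (suc i) xs)         ∎
    where open ≡-Reasoning

  q-down-braid : ∀ n → act D (q n) ∘ act D (down (suc n)) ≗ act D (reverse (down (suc n))) ∘ act D (q n)
  q-down-braid zero    xs = refl
  q-down-braid (suc n) xs = begin
    act D (q n ++ down (suc n)) (bk D (2 + n) (act D (down (suc n)) xs))
      ≡⟨ act-++ (q n) _ _ ⟩
    act D (q n) (act D (down (suc n)) (bk D (2 + n) (act D (down (suc n)) xs)))
      ≡⟨ q-down-braid n _ ⟩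
    act D up (act D (q n) (bk D (2 + n) (act D (down (suc n)) xs)))
      ≡⟨ cong (act D up) (bk-q-comm (suc n) n (n<1+n n) _) ⟨
    act D up (bk D (2 + n) (act D (q n) (act D (down (suc n)) xs)))
      ≡⟨ cong (act D up ∘ bk D (2 + n)) (act-++ (q n) _ xs) ⟨
    act D up (bk D (2 + n) (act D (q (suc n)) xs))
      ≡⟨ act-++ up (2 + n ∷ []) _ ⟨
    act D (up ++ 2 + n ∷ []) (act D (q (suc n)) xs)
      ≡⟨ cong (λ u → act D u (act D (q (suc n)) xs)) (unfold-reverse (2 + n) (down (suc n))) ⟨
    act D (reverse (down (2 + n))) (act D (q (suc n)) xs)
      ∎
    where open ≡-Reasoning
          up : List ℕ
          up = reverse (down (suc n))

  act-q-reverse : ∀ n → act D (q n) ≗ act D (reverse (q n))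
  act-q-reverse zero    xs = refl
  act-q-reverse (suc n) xs = begin
    act D (q n ++ down (suc n)) xs                   ≡⟨ act-++ (q n) _ xs ⟩
    act D (q n) (act D (down (suc n)) xs)            ≡⟨ q-down-braid n xs ⟩
    act D up (act D (q n) xs)                        ≡⟨ cong (act D up) (act-q-reverse n xs) ⟩
    act D up (act D (reverse (q n)) xs)              ≡⟨ act-++ up (reverse (q n)) xs ⟨
    act D (up ++ reverse (q n)) xs                   ≡⟨ cong (λ u → act D u xs) (reverse-++ (q n) (down (suc n))) ⟨
    act D (reverse (q n ++ down (suc n))) xs         ∎
    where open ≡-Reasoning
          up : List ℕ
          up = reverse (down (suc n))

  q-involutive : ∀ n → Involutive (act D (q n))
  q-involutive n xs = trans (act-q-reverse n _) (act-reverse (q n) xs)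

  palindrome-involutive : ∀ u v → Involutive (act D u) → Involutive (act D v) →
    Involutive (act D (u ++ v ++ u))
  palindrome-involutive u v u-inv v-inv xs = begin
    act D (u ++ v ++ u) (act D (u ++ v ++ u) xs)
      ≡⟨ trans (uvu _) (cong (act D u ∘ act D v ∘ act D u) (uvu xs)) ⟩
    act D u (act D v (act D u (act D u (act D v (act D u xs)))))  ≡⟨ cong (act D u ∘ act D v) (u-inv _) ⟩
    act D u (act D v (act D v (act D u xs)))                      ≡⟨ cong (act D u) (v-inv _) ⟩
    act D u (act D u xs)                                          ≡⟨ u-inv xs ⟩
    xs                                                            ∎
    where
      open ≡-Reasoning
      uvu : act D (u ++ v ++ u) ≗ act D u ∘ act D v ∘ act D u
      uvu ys = trans (act-++ u (v ++ u) ys) (cong (act D u) (act-++ v u ys))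

  involutive-square : ∀ w → Involutive (act D w) → act D (w ++ w) ≗ id
  involutive-square w w-inv xs = trans (act-++ w w xs) (w-inv xs)

  qjk-involutive : ∀ j k → Involutive (act D (qjk j k))
  qjk-involutive j k =
    palindrome-involutive (q (k ∸ 1)) (q (k ∸ j)) (q-involutive (k ∸ 1)) (q-involutive (k ∸ j))

  qjk-trivial : ∀ {j k} → k ≤ j → act D (qjk j k) ≗ id
  qjk-trivial {j} {k} k≤j xs = begin
    act D (q a ++ q (k ∸ j) ++ q a) xs  ≡⟨ cong (λ b → act D (q a ++ q b ++ q a) xs) (m≤n⇒m∸n≡0 k≤j) ⟩
    act D (q a ++ q a) xs               ≡⟨ involutive-square (q a) (q-involutive a) xs ⟩
    xs                                  ∎
    where open ≡-Reasoning
          a : ℕ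
          a = k ∸ 1

  cactusWord-trivial : ∀ i {j k} → k ≤ j → act D (cactusWord i j k) ≗ id
  cactusWord-trivial i {j} {k} k≤j xs = begin
    act D ((i ∷ W) ++ (i ∷ W)) xs          ≡⟨ act-++ (i ∷ W) (i ∷ W) xs ⟩
    bk D i (act D W (bk D i (act D W xs))) ≡⟨ cong (bk D i ∘ act D W ∘ bk D i) (qjk-trivial k≤j xs) ⟩
    bk D i (act D W (bk D i xs))           ≡⟨ cong (bk D i) (qjk-trivial k≤j _) ⟩
    bk D i (bk D i xs)                     ≡⟨ bk-involutive i xs ⟩
    xs                                     ∎
    where open ≡-Reasoning
          W : List ℕ
          W = qjk j k

swapAt-map : ∀ {D E : DecRel} (f : Fin (DecRel.size D) → Fin (DecRel.size E)) →
  (∀ x y → DecRel._≺_ D x y → DecRel._≺_ E (f x) (f y)) →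
  (∀ x y → DecRel._≺_ E (f x) (f y) → DecRel._≺_ D x y) →
  ∀ k xs → swapAt E k (map f xs) ≡ map f (swapAt D k xs)
swapAt-map {D} {E} f f⁺ f⁻ zero    []          = refl
swapAt-map {D} {E} f f⁺ f⁻ zero    (x ∷ [])    = refl
swapAt-map {D} {E} f f⁺ f⁻ zero    (x ∷ y ∷ r) with comparable? D x y
... | yes c = BenderKnuth.swapAt-comparable E (map f r) (⊎-map (f⁺ x y) (f⁺ y x) c)
... | no ¬c = BenderKnuth.swapAt-incomparable E (map f r) (¬c ∘ ⊎-map (f⁻ x y) (f⁻ y x))
swapAt-map {D} {E} f f⁺ f⁻ (suc k) []          = refl
swapAt-map {D} {E} f f⁺ f⁻ (suc k) (x ∷ r)     = cong (f x ∷_) (swapAt-map f f⁺ f⁻ k r)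

-- t₀ acts as t₁ (since 0 ∸ 1 = 0), so both are deleted.
lower : List ℕ → List ℕ
lower []                = []
lower (zero ∷ w)        = lower w
lower (suc zero ∷ w)    = lower w
lower (suc (suc i) ∷ w) = suc i ∷ lower w

lower-++ : ∀ u v → lower (u ++ v) ≡ lower u ++ lower v
lower-++ []                v = refl
lower-++ (zero ∷ u)        v = lower-++ u v
lower-++ (suc zero ∷ u)    v = lower-++ u v
lower-++ (suc (suc i) ∷ u) v = cong (suc i ∷_) (lower-++ u v)

lower-down : ∀ m → lower (down m) ≡ down (m ∸ 1)
lower-down zero          = refl
lower-down (suc zero)    = refl
lower-down (suc (suc m)) = cong (suc m ∷_) (lower-down (suc m))

lower-q : ∀ m → lower (q m) ≡ q (m ∸ 1)
lower-q zero    = refl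
lower-q (suc m) = begin
  lower (q m ++ down (suc m))    ≡⟨ lower-++ (q m) (down (suc m)) ⟩
  lower (q m) ++ lower (down (suc m)) ≡⟨ cong₂ _++_ (lower-q m) (lower-down (suc m)) ⟩
  q (m ∸ 1) ++ down m            ≡⟨ q-step m ⟩
  q m                            ∎
  where
    open ≡-Reasoning
    q-step : ∀ m → q (m ∸ 1) ++ down m ≡ q m
    q-step zero    = refl
    q-step (suc m) = refl

lower-qjk : ∀ j k → lower (qjk j k) ≡ qjk j (k ∸ 1)
lower-qjk j k = begin
  lower (q a ++ q (k ∸ j) ++ q a)                     ≡⟨ lower-++ (q a) _ ⟩
  lower (q a) ++ lower (q (k ∸ j) ++ q a)             ≡⟨ cong (lower (q a) ++_) (lower-++ (q (k ∸ j)) (q a)) ⟩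
  lower (q a) ++ lower (q (k ∸ j)) ++ lower (q a)     ≡⟨ cong₂ (λ x y → x ++ y ++ x) (lower-q a) (lower-q (k ∸ j)) ⟩
  q (a ∸ 1) ++ q (k ∸ j ∸ 1) ++ q (a ∸ 1)             ≡⟨ cong (λ b → q (a ∸ 1) ++ q b ++ q (a ∸ 1)) ∸-swap ⟩
  q (a ∸ 1) ++ q (a ∸ j) ++ q (a ∸ 1)                 ∎
  where
    open ≡-Reasoning
    a : ℕ
    a = k ∸ 1
    ∸-swap : k ∸ j ∸ 1 ≡ k ∸ 1 ∸ j
    ∸-swap = trans (∸-+-assoc k j 1) (trans (cong (k ∸_) (+-comm j 1)) (sym (∸-+-assoc k 1 j)))

lower-cactusWord₁ : ∀ j k → lower (cactusWord 1 j k) ≡ qjk j (k ∸ 1) ++ qjk j (k ∸ 1)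
lower-cactusWord₁ j k =
  trans (lower-++ (qjk j k) (1 ∷ qjk j k)) (cong₂ _++_ (lower-qjk j k) (lower-qjk j k))

lower-cactusWord : ∀ i j k → lower (cactusWord (2 + i) j k) ≡ cactusWord (suc i) j (k ∸ 1)
lower-cactusWord i j k =
  cong (suc i ∷_) (trans (lower-++ (qjk j k) (2 + i ∷ qjk j k))
                         (cong₂ (λ u v → u ++ suc i ∷ v) (lower-qjk j k) (lower-qjk j k)))

t₁-parity : List ℕ → Bool
t₁-parity []                = false
t₁-parity (zero ∷ w)        = not (t₁-parity w)
t₁-parity (suc zero ∷ w)    = not (t₁-parity w)
t₁-parity (suc (suc _) ∷ w) = t₁-parity w

t₁-parity-++ : ∀ u v → t₁-parity (u ++ v) ≡ t₁-parity u xor t₁-parity v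
t₁-parity-++ []                v = refl
t₁-parity-++ (zero ∷ u)        v = trans (cong not (t₁-parity-++ u v)) (not-distribˡ-xor (t₁-parity u) _)
t₁-parity-++ (suc zero ∷ u)    v = trans (cong not (t₁-parity-++ u v)) (not-distribˡ-xor (t₁-parity u) _)
t₁-parity-++ (suc (suc _) ∷ u) v = t₁-parity-++ u v

t₁-parity-square : ∀ w → t₁-parity (w ++ w) ≡ false
t₁-parity-square w = trans (t₁-parity-++ w w) (xor-same (t₁-parity w))

FixedByCactusWords : (D : DecRel) → ℕ → List (Fin (DecRel.size D)) → Set
FixedByCactusWords D N xs =
  ∀ i j k → 2 ≤ i + 1 → i + 1 < j → j < k → k ≤ N → act D (cactusWord i j k) xs ≡ xs

fixedByCactusWords : ∀ {D} → IsLECactus D → (L : LinExt D) →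
  FixedByCactusWords D (DecRel.size D) (LinExt.seq L)
fixedByCactusWords h L i j k 2≤i+1 i+1<j j<k k≤N = h i j k 2≤i+1 i+1<j j<k k≤N L

lower-fixes : ∀ D {N xs} → FixedByCactusWords D N xs →
  ∀ i j k → 2 ≤ i + 1 → i + 1 < j → j < k → k ≤ suc N → act D (lower (cactusWord i j k)) xs ≡ xs
lower-fixes D h zero j k (s≤s ()) _ _ _
lower-fixes D {xs = xs} h (suc zero) j k _ _ _ _ =
  trans (cong (λ w → act D w xs) (lower-cactusWord₁ j k))
        (involutive-square (qjk j (k ∸ 1)) (qjk-involutive j (k ∸ 1)) xs)
  where open BenderKnuth D
lower-fixes D {xs = xs} h (suc (suc i)) j k _ i+3<j _ k≤1+N =
  trans (cong (λ w → act D w xs) (lower-cactusWord i j k)) lowered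
  where
    open BenderKnuth D
    lowered : act D (cactusWord (suc i) j (k ∸ 1)) xs ≡ xs
    lowered with ≤-<-connex (k ∸ 1) j
    ... | inj₁ k∸1≤j = cactusWord-trivial (suc i) k∸1≤j xs
    ... | inj₂ j<k∸1 =
      h (suc i) j (k ∸ 1) (s≤s (m≤n+m 1 i)) (≤-trans (n≤1+n _) i+3<j) j<k∸1 (∸-monoˡ-≤ 1 k≤1+N)

module InversionFree (D : DecRel) where
  open DecRel D

  InversionFree : List (Fin size) → Set
  InversionFree []       = ⊤
  InversionFree (x ∷ xs) = ¬ x ≺ x × All (λ y → ¬ y ≺ x) xs × InversionFree xs

  order⇒inversionFree : ∀ xs → (∀ a b → lookup xs a ≺ lookup xs b → a Fin.< b) → InversionFree xs
  order⇒inversionFree []      _     = tt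
  order⇒inversionFree (x ∷ r) order =
      (λ x≺x → n≮0 (order zero zero x≺x))
    , All.tabulate (λ y∈r y≺x →
        n≮0 (order (suc (index y∈r)) zero (subst (_≺ x) (lookup-index y∈r) y≺x)))
    , order⇒inversionFree r (λ a b a≺b → ≤-pred (order (suc a) (suc b) a≺b))

  inversionFree⇒order : ∀ xs → InversionFree xs → ∀ a b → lookup xs a ≺ lookup xs b → a Fin.< b
  inversionFree⇒order (x ∷ r) (x⊀x , _ , _)    zero    zero    x≺x = ⊥-elim (x⊀x x≺x)
  inversionFree⇒order (x ∷ r) _                zero    (suc b) _   = s≤s z≤n
  inversionFree⇒order (x ∷ r) (_ , r⊀x , _)    (suc a) zero    y≺x = ⊥-elim (All.lookup r⊀x (∈-lookup a) y≺x)
  inversionFree⇒order (x ∷ r) (_ , _ , r-free) (suc a) (suc b) a≺b =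
    s≤s (inversionFree⇒order r r-free a b a≺b)

  linExt-inversionFree : (L : LinExt D) → InversionFree (LinExt.seq L)
  linExt-inversionFree L = order⇒inversionFree (LinExt.seq L) (LinExt.order L)

deleteZero : ∀ {n} → List (Fin (suc n)) → List (Fin n)
deleteZero []          = []
deleteZero (zero ∷ xs)  = deleteZero xs
deleteZero (suc x ∷ xs) = x ∷ deleteZero xs

deleteZero-∈ : ∀ {n} {x : Fin n} xs → suc x ∈ xs → x ∈ deleteZero xs
deleteZero-∈ (suc y ∷ xs) (here refl) = here refl
deleteZero-∈ (zero ∷ xs)  (there x∈)  = deleteZero-∈ xs x∈
deleteZero-∈ (suc y ∷ xs) (there x∈)  = there (deleteZero-∈ xs x∈)

deleteZero-All : ∀ {n} {P : Fin (suc n) → Set} {Q : Fin n → Set} → (∀ {x} → P (suc x) → Q x) →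
  ∀ {xs} → All P xs → All Q (deleteZero xs)
deleteZero-All f {[]}         []       = []
deleteZero-All f {zero ∷ xs}  (_ ∷ ps) = deleteZero-All f ps
deleteZero-All f {suc x ∷ xs} (p ∷ ps) = f p ∷ deleteZero-All f ps

deleteZero-unique : ∀ {n} {xs : List (Fin (suc n))} → Unique xs → Unique (deleteZero xs)
deleteZero-unique {xs = []}         []         = []
deleteZero-unique {xs = zero ∷ xs}  (_ ∷ u)    = deleteZero-unique u
deleteZero-unique {xs = suc x ∷ xs} (x∉ ∷ u)   =
  deleteZero-All (λ x≢y x≡y → x≢y (cong suc x≡y)) x∉ ∷ deleteZero-unique u

deleteZero-map-suc : ∀ {n} (xs : List (Fin n)) → deleteZero (map suc xs) ≡ xs
deleteZero-map-suc []       = refl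
deleteZero-map-suc (x ∷ xs) = cong (x ∷_) (deleteZero-map-suc xs)

map-suc-deleteZero : ∀ {n} (xs : List (Fin (suc n))) → All (zero ≢_) xs → map suc (deleteZero xs) ≡ xs
map-suc-deleteZero []          []          = refl
map-suc-deleteZero (zero ∷ xs)  (0≢0 ∷ _)   = ⊥-elim (0≢0 refl)
map-suc-deleteZero (suc x ∷ xs) (_ ∷ 0∉xs)  = cong (suc x ∷_) (map-suc-deleteZero xs 0∉xs)

map-suc²-deleteZero² : ∀ {n} (xs : List (Fin (2 + n))) → All (zero ≢_) xs → All (suc zero ≢_) xs →
  map suc (map suc (deleteZero (deleteZero xs))) ≡ xs
map-suc²-deleteZero² xs 0∉xs 1∉xs = begin
  map suc (map suc (deleteZero (deleteZero xs))) ≡⟨ cong (map suc) (map-suc-deleteZero (deleteZero xs) 0∉xs′) ⟩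
  map suc (deleteZero xs)                        ≡⟨ map-suc-deleteZero xs 0∉xs ⟩
  xs                                             ∎
  where
    open ≡-Reasoning
    0∉xs′ : All (zero ≢_) (deleteZero xs)
    0∉xs′ = deleteZero-All (λ 1≢sx 0≡x → 1≢sx (cong suc 0≡x)) 1∉xs

module OrdinalSum (R : DecRel) where
  open DecRel R using () renaming (size to n)
  open InversionFree

  A₁⊕R A₂⊕R : DecRel
  A₁⊕R = antichain 1 ⊕ R
  A₂⊕R = antichain 2 ⊕ R

  ⊕-suc⁺ : ∀ m {u v} → OrdSumRel (antichain m) R u v →
    OrdSumRel (antichain (suc m)) R (⊎-map₁ suc u) (⊎-map₁ suc v)
  ⊕-suc⁺ m (inQ ())
  ⊕-suc⁺ m QR      = QR
  ⊕-suc⁺ m (inR p) = inR p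

  ⊕-suc⁻ : ∀ m {u v} → OrdSumRel (antichain (suc m)) R (⊎-map₁ suc u) (⊎-map₁ suc v) →
    OrdSumRel (antichain m) R u v
  ⊕-suc⁻ m {inj₁ _} {inj₁ _} (inQ ())
  ⊕-suc⁻ m {inj₁ _} {inj₂ _} QR      = QR
  ⊕-suc⁻ m {inj₂ _} {inj₂ _} (inR p) = inR p

  deleteZero-inversionFree : ∀ m xs → InversionFree (antichain (suc m) ⊕ R) xs →
    InversionFree (antichain m ⊕ R) (deleteZero xs)
  deleteZero-inversionFree m []          _                         = tt
  deleteZero-inversionFree m (zero ∷ xs)  (_ , _ , xs-free)         = deleteZero-inversionFree m xs xs-free
  deleteZero-inversionFree m (suc x ∷ xs) (x⊀x , xs⊀x , xs-free)    =
      x⊀x ∘ ⊕-suc⁺ m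
    , deleteZero-All (λ y⊀x → y⊀x ∘ ⊕-suc⁺ m) xs⊀x
    , deleteZero-inversionFree m xs xs-free

  deleteZeroLinExt : ∀ m → LinExt (antichain (suc m) ⊕ R) → LinExt (antichain m ⊕ R)
  deleteZeroLinExt m L = record
    { seq      = deleteZero seq
    ; complete = λ x → deleteZero-∈ seq (complete (suc x))
    ; unique   = deleteZero-unique unique
    ; order    = inversionFree⇒order (antichain m ⊕ R) (deleteZero seq)
                   (deleteZero-inversionFree m seq (linExt-inversionFree (antichain (suc m) ⊕ R) L))
    }
    where open LinExt L

  fromAntichain₀⊕ : LinExt (antichain 0 ⊕ R) → LinExt R
  fromAntichain₀⊕ L = record
    { seq      = seq
    ; complete = complete
    ; unique   = unique
    ; order    = λ a b a≺b → order a b (inR a≺b)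
    }
    where open LinExt L

  linExt₁-shape : (L : LinExt A₁⊕R) → LinExt.seq L ≡ zero ∷ map suc (deleteZero (LinExt.seq L))
  linExt₁-shape L = shape (LinExt.seq L) (LinExt.complete L) (LinExt.unique L) (linExt-inversionFree A₁⊕R L)
    where
      shape : ∀ xs → (∀ x → x ∈ xs) → Unique xs → InversionFree A₁⊕R xs →
        xs ≡ zero ∷ map suc (deleteZero xs)
      shape []          complete _          _ with complete zero
      ... | ()
      shape (zero ∷ xs)  _        (0∉xs ∷ _) _ = cong (zero ∷_) (sym (map-suc-deleteZero xs 0∉xs))
      shape (suc x ∷ xs) complete _          (_ , xs⊀x , _) with complete zero
      ... | there 0∈xs = ⊥-elim (All.lookup xs⊀x 0∈xs QR)

  heads : Bool → List (Fin (2 + n))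
  heads false = zero ∷ suc zero ∷ []
  heads true  = suc zero ∷ zero ∷ []

  linExt₂-shape : (L : LinExt A₂⊕R) →
    ∃ λ b → LinExt.seq L ≡ heads b ++ map suc (map suc (deleteZero (deleteZero (LinExt.seq L))))
  linExt₂-shape L = shape (LinExt.seq L) (LinExt.complete L) (LinExt.unique L) (linExt-inversionFree A₂⊕R L)
    where
      shape : ∀ xs → (∀ x → x ∈ xs) → Unique xs → InversionFree A₂⊕R xs →
        ∃ λ b → xs ≡ heads b ++ map suc (map suc (deleteZero (deleteZero xs)))
      shape [] complete _ _ with complete zero
      ... | ()
      shape (x ∷ []) complete _ _ with complete zero | complete (suc zero)
      ... | here refl | here ()
      ... | _         | there ()
      shape (suc (suc x) ∷ xs) complete _ (_ , xs⊀x , _) with complete zero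
      ... | there 0∈xs = ⊥-elim (All.lookup xs⊀x 0∈xs QR)
      shape (zero ∷ zero ∷ xs) _ ((0≢0 ∷ _) ∷ _) _ = ⊥-elim (0≢0 refl)
      shape (suc zero ∷ suc zero ∷ xs) _ ((1≢1 ∷ _) ∷ _) _ = ⊥-elim (1≢1 refl)
      shape (zero ∷ suc zero ∷ xs) _ ((_ ∷ 0∉xs) ∷ 1∉xs ∷ _) _ =
        false , cong (λ ys → zero ∷ suc zero ∷ ys) (sym (map-suc²-deleteZero² xs 0∉xs 1∉xs))
      shape (suc zero ∷ zero ∷ xs) _ ((_ ∷ 1∉xs) ∷ 0∉xs ∷ _) _ =
        true , cong (λ ys → suc zero ∷ zero ∷ ys) (sym (map-suc²-deleteZero² xs 0∉xs 1∉xs))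
      shape (zero ∷ suc (suc y) ∷ xs) complete _ (_ , _ , _ , xs⊀y , _) with complete (suc zero)
      ... | there (there 1∈xs) = ⊥-elim (All.lookup xs⊀y 1∈xs QR)
      shape (suc zero ∷ suc (suc y) ∷ xs) complete _ (_ , _ , _ , xs⊀y , _) with complete zero
      ... | there (there 0∈xs) = ⊥-elim (All.lookup xs⊀y 0∈xs QR)

  suc-swapAt₁ : ∀ k xs → swapAt A₁⊕R k (map suc xs) ≡ map suc (swapAt R k xs)
  suc-swapAt₁ = swapAt-map suc (λ _ _ p → inR p) (λ { _ _ (inR p) → p })

  suc-swapAt₂ : ∀ k xs → swapAt A₂⊕R k (map suc xs) ≡ map suc (swapAt A₁⊕R k xs)
  suc-swapAt₂ = swapAt-map suc (λ x y → ⊕-suc⁺ 1 {Fin.splitAt 1 x} {Fin.splitAt 1 y})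
                               (λ x y → ⊕-suc⁻ 1 {Fin.splitAt 1 x} {Fin.splitAt 1 y})

  act-A₁⊕R : ∀ w xs → act A₁⊕R w (zero ∷ map suc xs) ≡ zero ∷ map suc (act R (lower w) xs)
  act-A₁⊕R []                xs = refl
  act-A₁⊕R (zero ∷ w)        xs = trans (cong (swapAt A₁⊕R 0) (act-A₁⊕R w xs)) (bottom-fixed _)
    where open BenderKnuth A₁⊕R
          bottom-fixed : ∀ ys → swapAt A₁⊕R 0 (zero ∷ map suc ys) ≡ zero ∷ map suc ys
          bottom-fixed []       = refl
          bottom-fixed (_ ∷ ys) = swapAt-comparable (map suc ys) (inj₁ QR)
  act-A₁⊕R (suc zero ∷ w)    xs = act-A₁⊕R (zero ∷ w) xs
  act-A₁⊕R (suc (suc i) ∷ w) xs =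
    trans (cong (swapAt A₁⊕R (suc i)) (act-A₁⊕R w xs)) (cong (zero ∷_) (suc-swapAt₁ i _))

  act-A₂⊕R : ∀ w b xs → act A₂⊕R w (heads b ++ map suc (map suc xs)) ≡
    heads (b xor t₁-parity w) ++ map suc (map suc (act R (lower (lower w)) xs))
  act-A₂⊕R []                    b xs = cong (λ c → heads c ++ map suc (map suc xs)) (sym (xor-identityʳ b))
  act-A₂⊕R (zero ∷ w)            b xs = begin
    swapAt A₂⊕R 0 (act A₂⊕R w (heads b ++ map suc (map suc xs)))   ≡⟨ cong (swapAt A₂⊕R 0) (act-A₂⊕R w b xs) ⟩
    swapAt A₂⊕R 0 (heads (b xor t₁-parity w) ++ tail)               ≡⟨ heads-swapped (b xor t₁-parity w) tail ⟩
    heads (not (b xor t₁-parity w)) ++ tail                         ≡⟨ cong (λ c → heads c ++ tail) (not-distribʳ-xor b _) ⟩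
    heads (b xor not (t₁-parity w)) ++ tail                         ∎
    where
      open ≡-Reasoning
      open BenderKnuth A₂⊕R
      tail : List (Fin (2 + n))
      tail = map suc (map suc (act R (lower (lower w)) xs))
      heads-swapped : ∀ c ys → swapAt A₂⊕R 0 (heads c ++ ys) ≡ heads (not c) ++ ys
      heads-swapped false ys = swapAt-incomparable ys λ { (inj₁ (inQ ())) ; (inj₂ (inQ ())) }
      heads-swapped true  ys = swapAt-incomparable ys λ { (inj₁ (inQ ())) ; (inj₂ (inQ ())) }
  act-A₂⊕R (suc zero ∷ w)        b xs = act-A₂⊕R (zero ∷ w) b xs
  act-A₂⊕R (suc (suc zero) ∷ w)  b xs =
    trans (cong (swapAt A₂⊕R 1) (act-A₂⊕R w b xs)) (heads-fixed (b xor t₁-parity w) _)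
    where
      open BenderKnuth A₂⊕R
      heads-fixed : ∀ c ys →
        swapAt A₂⊕R 1 (heads c ++ map suc (map suc ys)) ≡ heads c ++ map suc (map suc ys)
      heads-fixed false []       = refl
      heads-fixed true  []       = refl
      heads-fixed false (_ ∷ ys) = cong (zero ∷_) (swapAt-comparable (map suc (map suc ys)) (inj₁ QR))
      heads-fixed true  (_ ∷ ys) = cong (suc zero ∷_) (swapAt-comparable (map suc (map suc ys)) (inj₁ QR))
  act-A₂⊕R (suc (suc (suc i)) ∷ w) b xs = begin
    swapAt A₂⊕R (2 + i) (act A₂⊕R w (heads b ++ map suc (map suc xs)))
      ≡⟨ cong (swapAt A₂⊕R (2 + i)) (act-A₂⊕R w b xs) ⟩
    swapAt A₂⊕R (2 + i) (heads c ++ map suc (map suc ys))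
      ≡⟨ heads-untouched c ⟩
    heads c ++ swapAt A₂⊕R i (map suc (map suc ys))
      ≡⟨ cong (heads c ++_) (trans (suc-swapAt₂ i (map suc ys)) (cong (map suc) (suc-swapAt₁ i ys))) ⟩
    heads c ++ map suc (map suc (swapAt R i ys))
      ∎
    where
      open ≡-Reasoning
      c : Bool
      c = b xor t₁-parity w
      ys : List (Fin n)
      ys = act R (lower (lower w)) xs
      heads-untouched : ∀ c → swapAt A₂⊕R (2 + i) (heads c ++ map suc (map suc ys)) ≡
                              heads c ++ swapAt A₂⊕R i (map suc (map suc ys))
      heads-untouched false = refl
      heads-untouched true  = refl

  cactus-A₁⊕R : IsLECactus R → IsLECactus A₁⊕R
  cactus-A₁⊕R h i j k 2≤i+1 i+1<j j<k k≤1+n L = begin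
    act A₁⊕R w (LinExt.seq L)            ≡⟨ cong (act A₁⊕R w) (linExt₁-shape L) ⟩
    act A₁⊕R w (zero ∷ map suc r)        ≡⟨ act-A₁⊕R w r ⟩
    zero ∷ map suc (act R (lower w) r)   ≡⟨ cong (λ ys → zero ∷ map suc ys) r-fixed ⟩
    zero ∷ map suc r                     ≡⟨ linExt₁-shape L ⟨
    LinExt.seq L                         ∎
    where
      open ≡-Reasoning
      w : List ℕ
      w = cactusWord i j k
      L′ : LinExt R
      L′ = fromAntichain₀⊕ (deleteZeroLinExt 0 L)
      r : List (Fin n)
      r = LinExt.seq L′
      r-fixed : act R (lower w) r ≡ r
      r-fixed = lower-fixes R (fixedByCactusWords h L′) i j k 2≤i+1 i+1<j j<k k≤1+n

  cactus-A₂⊕R : IsLECactus A₁⊕R → IsLECactus A₂⊕R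
  cactus-A₂⊕R h i j k 2≤i+1 i+1<j j<k k≤2+n L with linExt₂-shape L
  ... | b , seq≡ = begin
    act A₂⊕R w (LinExt.seq L)                                            ≡⟨ cong (act A₂⊕R w) seq≡ ⟩
    act A₂⊕R w (heads b ++ map suc (map suc r))                          ≡⟨ act-A₂⊕R w b r ⟩
    heads (b xor t₁-parity w) ++ map suc (map suc (act R (lower (lower w)) r))
      ≡⟨ cong₂ (λ c ys → heads c ++ map suc (map suc ys)) heads-fixed r-fixed ⟩
    heads b ++ map suc (map suc r)                                       ≡⟨ seq≡ ⟨
    LinExt.seq L                                                         ∎
    where
      open ≡-Reasoning
      w : List ℕ
      w = cactusWord i j k
      L′ : LinExt A₁⊕R
      L′ = deleteZeroLinExt 1 L
      r : List (Fin n)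
      r = deleteZero (LinExt.seq L′)
      heads-fixed : b xor t₁-parity w ≡ b
      heads-fixed = trans (cong (b xor_) (t₁-parity-square (i ∷ qjk j k))) (xor-identityʳ b)
      r-fixed : act R (lower (lower w)) r ≡ r
      r-fixed = map-injective suc-injective (∷-injectiveʳ (begin
        zero ∷ map suc (act R (lower (lower w)) r) ≡⟨ act-A₁⊕R (lower w) r ⟨
        act A₁⊕R (lower w) (zero ∷ map suc r)      ≡⟨ cong (act A₁⊕R (lower w)) (linExt₁-shape L′) ⟨
        act A₁⊕R (lower w) (LinExt.seq L′)
          ≡⟨ lower-fixes A₁⊕R (fixedByCactusWords h L′) i j k 2≤i+1 i+1<j j<k k≤2+n ⟩
        LinExt.seq L′                              ≡⟨ linExt₁-shape L′ ⟩
        zero ∷ map suc r                           ∎))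

proposition3p19 : (P : FinPoset) →
    (IsLECactus (antichain 1 ⊕ FinPoset.rel P) → IsLECactus (antichain 2 ⊕ FinPoset.rel P))
    × (IsLECactus (FinPoset.rel P) →
       IsLECactus (antichain 1 ⊕ FinPoset.rel P) × IsLECactus (antichain 2 ⊕ FinPoset.rel P))
proposition3p19 P = cactus-A₂⊕R , λ h → cactus-A₁⊕R h , cactus-A₂⊕R (cactus-A₁⊕R h)
  where open OrdinalSum (FinPoset.rel P)
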